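{- Let $J$ be a jellyfish graph with head $H$ and legs isomorphic to the rooted tree $L$. A subset $S\subseteq V(J)$ is a fixing set of $J$ if and only if (i) for every $v\in V(H)$, $S_v=S\cap V(L_v)$ is a fixing set of the rooted tree $L_v$, and (ii) $S_{proj}=\{v\in V(H): S_v\neq\emptyset\}$ is a fixing set of $H$.
   Context: A subset $S\subseteq V(G)$ is a fixing set of $G$ if the only automorphism $\pi$ of $G$ with $\pi(s)=s$ for all $s\in S$ is the identity; for a rooted tree, automorphisms are required to fix the root. A jellyfish graph $J$ is described by a graph $H$ (the head), which contains a Hamiltonian cycle, and a rooted tree $L$: for each vertex $v\in V(H)$ there is a leg $L_v$, a rooted tree with root $v$ isomorphic (as a rooted tree) to $L$; distinct legs are vertex-disjoint, $V(J)$ is the union of the legs, and $E(J)$ consists of the edges of $H$ together with the edges of all legs. -}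

module Defs where

open import Data.Nat using (ℕ; zero; suc; _≤_; _<_)
open import Data.Fin using (Fin; zero; suc; toℕ; _≟_)
open import Data.Bool using (Bool; true; false; _∧_; _∨_)
open import Data.Product using (Σ; ∃; _×_; _,_; proj₁; proj₂)
open import Data.Sum using (_⊎_)
open import Function.Bundles using (_↔_; Inverse)
open import Relation.Binary.PropositionalEquality using (_≡_)
open import Relation.Nullary.Decidable using (⌊_⌋)

record Graph : Set₁ where
  field
    V   : Set
    adj : V → V → Bool

open Graph public

VSet : Set → Set₁
VSet A = A → Set

record Automorphism (G : Graph) : Set where
  field
    perm      : V G ↔ V G
    preserves : ∀ x y → adj G (Inverse.to perm x) (Inverse.to perm y) ≡ adj G x y

  app : V G → V G
  app = Inverse.to perm

open Automorphism public

IsFixingSet : (G : Graph) → VSet (V G) → Set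
IsFixingSet G S =
  (π : Automorphism G) → (∀ s → S s → app π s ≡ s) → ∀ x → app π x ≡ x

IsFixingSetRooted : (G : Graph) → V G → VSet (V G) → Set
IsFixingSetRooted G r S =
  (π : Automorphism G) → app π r ≡ r →
  (∀ s → S s → app π s ≡ s) → ∀ x → app π x ≡ x

induced : (G : Graph) → VSet (V G) → Graph
induced G P = record { V = Σ (V G) P ; adj = λ x y → adj G (proj₁ x) (proj₁ y) }

record SimpleGraph (n : ℕ) : Set where
  field
    hadj   : Fin n → Fin n → Bool
    sym    : ∀ x y → hadj x y ≡ hadj y x
    irrefl : ∀ x → hadj x x ≡ false

open SimpleGraph public

toGraph : ∀ {n} → SimpleGraph n → Graph
toGraph {n} H = record { V = Fin n ; adj = hadj H }

record HamiltonianCycle {n : ℕ} (H : SimpleGraph n) : Set where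
  field
    atLeast3 : 3 ≤ n
    c        : Fin n → Fin n
    c-inj    : ∀ i j → c i ≡ c j → i ≡ j
    c-adj    : ∀ (i j : Fin n) →
               (suc (toℕ i) ≡ toℕ j ⊎ (suc (toℕ i) ≡ n × toℕ j ≡ 0)) →
               hadj H (c i) (c j) ≡ true

-- Finite rooted trees: vertex set Fin (suc k), root zero, and every
-- non-root vertex suc i has a parent with a smaller index.  Every finite
-- rooted tree is isomorphic (as a rooted tree) to one of this form.

record RootedTree : Set where
  field
    k        : ℕ
    parent   : Fin k → Fin (suc k)
    parent-< : ∀ i → toℕ (parent i) < suc (toℕ i)

open RootedTree public

childOf : (L : RootedTree) → Fin (suc (k L)) → Fin (suc (k L)) → Bool
childOf L zero    y = false
childOf L (suc i) y = ⌊ parent L i ≟ y ⌋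

treeAdj : (L : RootedTree) → Fin (suc (k L)) → Fin (suc (k L)) → Bool
treeAdj L x y = childOf L x y ∨ childOf L y x

-- Jellyfish graph with head H and legs isomorphic to L.
-- Vertex (v , a) is the copy of vertex a of L in the leg L_v; the copy
-- (v , zero) of the root of L is identified with the head vertex v.

isRoot : ∀ {m} → Fin (suc m) → Bool
isRoot zero    = true
isRoot (suc _) = false

jellyfishAdj : ∀ {n} → SimpleGraph n → (L : RootedTree) →
               Fin n × Fin (suc (k L)) → Fin n × Fin (suc (k L)) → Bool
jellyfishAdj H L (u , a) (v , b) =
  (⌊ u ≟ v ⌋ ∧ treeAdj L a b) ∨ (isRoot a ∧ isRoot b ∧ hadj H u v)

jellyfish : ∀ {n} → SimpleGraph n → RootedTree → Graph
jellyfish {n} H L = record { V = Fin n × Fin (suc (k L)) ; adj = jellyfishAdj H L }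

legVertex : ∀ {n} (L : RootedTree) → Fin n → VSet (Fin n × Fin (suc (k L)))
legVertex L v x = proj₁ x ≡ v

leg : ∀ {n} → SimpleGraph n → (L : RootedTree) → Fin n → Graph
leg H L v = induced (jellyfish H L) (legVertex L v)

legRoot : ∀ {n} (H : SimpleGraph n) (L : RootedTree) (v : Fin n) → V (leg H L v)
legRoot H L v = (v , zero) , Relation.Binary.PropositionalEquality.refl

legSet : ∀ {n} (H : SimpleGraph n) (L : RootedTree) →
         VSet (Fin n × Fin (suc (k L))) → (v : Fin n) → VSet (V (leg H L v))
legSet H L S v x = S (proj₁ x)

projSet : ∀ {n} (L : RootedTree) → VSet (Fin n × Fin (suc (k L))) → VSet (Fin n)
projSet L S v = ∃ λ a → S (v , a)

-- Inside J the head can be recognised: along the Hamiltonian cycle every root has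
-- two distinct root neighbours, while no vertex set with that property meets a leg
-- below its root, since every vertex of such a set would have a child in the set,
-- giving an infinite chain of ever deeper descendants.  Hence every automorphism π
-- of J permutes the roots, inducing an automorphism σ of H, and, as non-roots stay
-- non-roots and have neighbours only in their own leg, π carries L_v onto L_{σ v}.
-- If S satisfies (i) and (ii), σ fixes S_proj and is the identity; then π restricts
-- to a root-fixing automorphism of each leg fixing S_v, which is the identity.
-- Conversely a root-fixing automorphism of a leg extends by the identity, and an
-- automorphism of H lifts leg-wise, to automorphisms of J fixing S.
module Submission where

open import Defs hiding (sym)
open import Data.Nat as ℕ using (ℕ; zero; suc; _≤_; s≤s)
import Data.Nat.Properties as ℕ
open import Data.Fin using (Fin; zero; suc; toℕ; _≟_; _<_; _>_; fromℕ; fromℕ<; inject₁; punchOut)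
open import Data.Fin.Properties
  using (any?; pigeonhole; punchOut-injective; <⇒≢; 0≢1+n; toℕ<n; toℕ-fromℕ<; toℕ-fromℕ; toℕ-inject₁)
open import Data.Fin.Induction using (<-wellFounded; >-wellFounded)
open import Data.Bool using (true; _∧_; _∨_)
open import Data.Bool.Properties using (∧-zeroʳ)
open import Data.Product using (Σ; ∃; _×_; _,_; proj₁; proj₂; map₁)
open import Data.Sum using (_⊎_; inj₁; inj₂)
open import Function.Base using (_∘_)
open import Function.Bundles using (Inverse; mk↔ₛ′; _⇔_; mk⇔)
open import Induction.WellFounded using (Acc; acc)
open import Axiom.UniquenessOfIdentityProofs using (module Decidable⇒UIP)
open import Relation.Binary.PropositionalEquality
open import Relation.Nullary using (¬_; Dec; yes; no; contradiction)
open import Relation.Nullary.Decidable using (⌊_⌋)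

module _ {G : Graph} where

  mkAutomorphism : (f g : V G → V G) → (∀ y → f (g y) ≡ y) → (∀ x → g (f x) ≡ x) →
                   (∀ x y → adj G (f x) (f y) ≡ adj G x y) → Automorphism G
  mkAutomorphism f g f∘g g∘f f-adj = record { perm = mk↔ₛ′ f g f∘g g∘f ; preserves = f-adj }

  _⁻¹ : Automorphism G → Automorphism G
  π ⁻¹ = mkAutomorphism (Inverse.from (perm π)) (app π) from∘to to∘from λ x y →
    trans (sym (preserves π _ _)) (cong₂ (adj G) (to∘from x) (to∘from y))
    where
    to∘from : ∀ y → app π (Inverse.from (perm π) y) ≡ y
    to∘from = Inverse.strictlyInverseˡ (perm π)
    from∘to : ∀ x → Inverse.from (perm π) (app π x) ≡ x
    from∘to = Inverse.strictlyInverseʳ (perm π)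

  module _ (π : Automorphism G) where

    app-⁻¹ : ∀ y → app π (app (π ⁻¹) y) ≡ y
    app-⁻¹ = Inverse.strictlyInverseˡ (perm π)

    ⁻¹-app : ∀ x → app (π ⁻¹) (app π x) ≡ x
    ⁻¹-app = Inverse.strictlyInverseʳ (perm π)

    app-injective : ∀ {x y} → app π x ≡ app π y → x ≡ y
    app-injective {x} {y} e = trans (sym (⁻¹-app x)) (trans (cong (app (π ⁻¹)) e) (⁻¹-app y))

MinDegree≥2 : (G : Graph) → VSet (V G) → Set
MinDegree≥2 G P = ∀ x → P x → Σ (V G) λ y₁ → Σ (V G) λ y₂ →
  P y₁ × P y₂ × ¬ y₁ ≡ y₂ × adj G x y₁ ≡ true × adj G x y₂ ≡ true

image : {G : Graph} → Automorphism G → VSet (V G) → VSet (V G)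
image π P y = ∃ λ x → P x × app π x ≡ y

image-minDegree≥2 : ∀ {G P} (π : Automorphism G) → MinDegree≥2 G P → MinDegree≥2 G (image π P)
image-minDegree≥2 π deg _ (x , px , refl) with deg x px
... | y₁ , y₂ , p₁ , p₂ , y₁≢y₂ , e₁ , e₂ =
  app π y₁ , app π y₂ , (y₁ , p₁ , refl) , (y₂ , p₂ , refl) , (λ e → y₁≢y₂ (app-injective π e)) ,
  trans (preserves π x y₁) e₁ , trans (preserves π x y₂) e₂

PreservesAdjOutside : (G : Graph) (P : VSet (V G)) → Automorphism (induced G P) → Set
PreservesAdjOutside G P ρ = ∀ x y → ¬ P y →
  adj G (proj₁ (app ρ x)) y ≡ adj G (proj₁ x) y × adj G y (proj₁ (app ρ x)) ≡ adj G y (proj₁ x)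

module _ {G : Graph} {P : VSet (V G)} (P-irrelevant : ∀ x (p q : P x) → p ≡ q) where

  induced-≡ : {x y : V (induced G P)} → proj₁ x ≡ proj₁ y → x ≡ y
  induced-≡ {x , p} {_ , q} refl = cong (x ,_) (P-irrelevant x p q)

  restrict : (π : Automorphism G) → (∀ {x} → P x → P (app π x)) → (∀ {x} → P (app π x) → P x) →
             Automorphism (induced G P)
  restrict π π-P π-P⁻ = mkAutomorphism to from
    (λ (y , _) → induced-≡ (app-⁻¹ π y)) (λ (x , _) → induced-≡ (⁻¹-app π x))
    (λ x y → preserves π (proj₁ x) (proj₁ y))
    where
    to from : V (induced G P) → V (induced G P)
    to (x , p) = app π x , π-P p
    from (y , q) = app (π ⁻¹) y , π-P⁻ (subst P (sym (app-⁻¹ π y)) q)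

  module _ (P? : ∀ x → Dec (P x)) where

    extendMap : (V (induced G P) → V (induced G P)) → V G → V G
    extendMap f x with P? x
    ... | yes p = proj₁ (f (x , p))
    ... | no _  = x

    extendMap-inside : ∀ f {x} (p : P x) → extendMap f x ≡ proj₁ (f (x , p))
    extendMap-inside f {x} p with P? x
    ... | yes p′ = cong (λ q → proj₁ (f (x , q))) (P-irrelevant x p′ p)
    ... | no ¬p  = contradiction p ¬p

    extendMap-outside : ∀ f {x} → ¬ P x → extendMap f x ≡ x
    extendMap-outside f {x} ¬p with P? x
    ... | yes p = contradiction p ¬p
    ... | no _  = refl

    extendMap-inverse : ∀ f g → (∀ y → f (g y) ≡ y) → ∀ x → extendMap f (extendMap g x) ≡ x
    extendMap-inverse f g f∘g x with P? x
    ... | yes p = trans (extendMap-inside f (proj₂ (g (x , p)))) (cong proj₁ (f∘g (x , p)))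
    ... | no ¬p = extendMap-outside f ¬p

    extendMap-preserves : (ρ : Automorphism (induced G P)) → PreservesAdjOutside G P ρ →
                          ∀ x y → adj G (extendMap (app ρ) x) (extendMap (app ρ) y) ≡ adj G x y
    extendMap-preserves ρ ρ-out x y with P? x | P? y
    ... | yes p | yes q = preserves ρ (x , p) (y , q)
    ... | yes p | no ¬q = proj₁ (ρ-out (x , p) y ¬q)
    ... | no ¬p | yes q = proj₂ (ρ-out (y , q) x ¬p)
    ... | no _  | no _  = refl

    extend : (ρ : Automorphism (induced G P)) → PreservesAdjOutside G P ρ → Automorphism G
    extend ρ ρ-out = mkAutomorphism (extendMap (app ρ)) (extendMap (app (ρ ⁻¹)))
      (extendMap-inverse _ _ (app-⁻¹ ρ)) (extendMap-inverse _ _ (⁻¹-app ρ))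
      (extendMap-preserves ρ ρ-out)

    fixingSet-fixesExtendable : ∀ {S} → IsFixingSet G S →
      (ρ : Automorphism (induced G P)) → PreservesAdjOutside G P ρ →
      (∀ x → S (proj₁ x) → app ρ x ≡ x) → ∀ x → app ρ x ≡ x
    fixingSet-fixesExtendable {S} S-fixing ρ ρ-out ρ-fixes (x , p) =
      induced-≡ (trans (sym (extendMap-inside (app ρ) p)) (S-fixing (extend ρ ρ-out) fixes x))
      where
      fixes : ∀ s → S s → extendMap (app ρ) s ≡ s
      fixes s s∈S with P? s
      ... | yes q = cong proj₁ (ρ-fixes (s , q) s∈S)
      ... | no _  = refl

injective⇒surjective : ∀ {n} (f : Fin n → Fin n) → (∀ i j → f i ≡ f j → i ≡ j) →
                       ∀ v → ∃ λ i → f i ≡ v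
injective⇒surjective {suc m} f f-inj v with any? (λ i → f i ≟ v)
... | yes v∈im = v∈im
... | no v∉im with pigeonhole (ℕ.n<1+n m) (λ i → punchOut (λ e → v∉im (i , sym e)))
...   | i , j , i<j , eq = contradiction
  (f-inj i j (punchOut-injective (λ e → v∉im (i , sym e)) (λ e → v∉im (j , sym e)) eq)) (<⇒≢ i<j)

⌊≟⌋-injective : ∀ {m m′} (f : Fin m → Fin m′) → (∀ {u u′} → f u ≡ f u′ → u ≡ u′) →
                ∀ u u′ → ⌊ f u ≟ f u′ ⌋ ≡ ⌊ u ≟ u′ ⌋
⌊≟⌋-injective f f-inj u u′ with f u ≟ f u′ | u ≟ u′
... | yes _     | yes _    = refl
... | no _      | no _     = refl
... | yes e     | no u≢u′  = contradiction (f-inj e) u≢u′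
... | no fu≢fu′ | yes refl = contradiction refl fu≢fu′

IsCyclicSuccessor : ∀ {n} → Fin n → Fin n → Set
IsCyclicSuccessor {n} i j = suc (toℕ i) ≡ toℕ j ⊎ (suc (toℕ i) ≡ n × toℕ j ≡ 0)

cyclicSuccessor : ∀ {n} (i : Fin n) → ∃ (IsCyclicSuccessor i)
cyclicSuccessor {suc m} i with suc (toℕ i) ℕ.<? suc m
... | yes i+1<n = fromℕ< i+1<n , inj₁ (sym (toℕ-fromℕ< i+1<n))
... | no i+1≮n  = zero , inj₂ (ℕ.≤-antisym (toℕ<n i) (ℕ.≮⇒≥ i+1≮n) , refl)

cyclicPredecessor : ∀ {n} (j : Fin n) → ∃ λ i → IsCyclicSuccessor i j
cyclicPredecessor {suc m} zero    = fromℕ m , inj₂ (cong suc (toℕ-fromℕ m) , refl)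
cyclicPredecessor {suc m} (suc j) = inject₁ j , inj₁ (cong suc (toℕ-inject₁ j))

isCyclicSuccessor-asym : ∀ {n} {i j : Fin n} → 3 ≤ n → IsCyclicSuccessor i j → ¬ IsCyclicSuccessor j i
isCyclicSuccessor-asym {n} {i} {j} 3≤n = asym (toℕ i) (toℕ j)
  where
  asym : ∀ x y → suc x ≡ y ⊎ (suc x ≡ n × y ≡ 0) → ¬ (suc y ≡ x ⊎ (suc y ≡ n × x ≡ 0))
  asym x _ (inj₁ refl) (inj₁ e) = ℕ.<-irrefl (sym e) (ℕ.m<n⇒m<1+n (ℕ.n<1+n x))
  asym _ _ (inj₁ refl) (inj₂ (refl , refl)) = contradiction 3≤n λ { (s≤s (s≤s ())) }
  asym _ _ (inj₂ (refl , refl)) (inj₁ refl) = contradiction 3≤n λ { (s≤s (s≤s ())) }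
  asym _ _ (inj₂ (refl , refl)) (inj₂ (_ , refl)) = contradiction 3≤n λ { (s≤s ()) }

module _ (L : RootedTree) where

  parent≡suc⇒< : ∀ {a c} → parent L c ≡ suc a → a < c
  parent≡suc⇒< {a} {c} eq = ℕ.≤-pred (subst (λ p → toℕ p ℕ.< suc (toℕ c)) eq (parent-< L c))

  parent-induction : (Q : Fin (suc (k L)) → Set) → Q zero → (∀ i → Q (parent L i) → Q (suc i)) →
                     ∀ a → Q a
  parent-induction Q Q-root Q-step a = go (<-wellFounded a)
    where
    go : ∀ {a} → Acc _<_ a → Q a
    go {zero}  _         = Q-root
    go {suc i} (acc rec) = Q-step i (go (rec (parent-< L i)))

module Jellyfish {n : ℕ} (H : SimpleGraph n) (L : RootedTree) where

  Vertex : Set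
  Vertex = Fin n × Fin (suc (k L))

  Root : VSet Vertex
  Root x = proj₂ x ≡ zero

  adj-roots : ∀ u v → jellyfishAdj H L (u , zero) (v , zero) ≡ hadj H u v
  adj-roots u v = cong (_∨ hadj H u v) (∧-zeroʳ ⌊ u ≟ v ⌋)

  adj-otherLeg : ∀ {u a v b} → ¬ u ≡ v →
    jellyfishAdj H L (u , a) (v , b) ≡ (isRoot a ∧ isRoot b ∧ hadj H u v)
  adj-otherLeg {u} {_} {v} u≢v with u ≟ v
  ... | yes u≡v = contradiction u≡v u≢v
  ... | no _    = refl

  adj-otherLeg-≡ : ∀ {x x′ y : Vertex} → proj₁ x ≡ proj₁ x′ → isRoot (proj₂ x) ≡ isRoot (proj₂ x′) →
    ¬ proj₁ x ≡ proj₁ y →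
    jellyfishAdj H L x y ≡ jellyfishAdj H L x′ y × jellyfishAdj H L y x ≡ jellyfishAdj H L y x′
  adj-otherLeg-≡ {u , a} {_ , a′} {v , b} refl root-eq u≢v =
    trans (adj-otherLeg {a = a} {b = b} u≢v)
          (trans (cong (λ r → r ∧ isRoot b ∧ hadj H u v) root-eq) (sym (adj-otherLeg {a = a′} {b = b} u≢v))) ,
    trans (adj-otherLeg {a = b} {b = a} v≢u)
          (trans (cong (λ r → isRoot b ∧ r ∧ hadj H v u) root-eq) (sym (adj-otherLeg {a = b} {b = a′} v≢u)))
    where
    v≢u : ¬ v ≡ u
    v≢u = u≢v ∘ sym

  adj-parent : ∀ v i → jellyfishAdj H L (v , suc i) (v , parent L i) ≡ true
  adj-parent v i with v ≟ v | parent L i ≟ parent L i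
  ... | yes _ | yes _ = refl
  ... | no v≢v | _    = contradiction refl v≢v
  ... | _ | no p≢p    = contradiction refl p≢p

  adj-nonroot : ∀ {w a u b} → jellyfishAdj H L (w , suc a) (u , b) ≡ true →
                u ≡ w × (b ≡ parent L a ⊎ ∃ λ c → b ≡ suc c × a < c)
  adj-nonroot {w} {a} {u} {b} e with w ≟ u
  adj-nonroot () | no _
  adj-nonroot {a = a} {b = b} e | yes refl with parent L a ≟ b
  ... | yes eq = refl , inj₁ (sym eq)
  adj-nonroot {b = zero} () | yes refl | no _
  adj-nonroot {a = a} {b = suc c} e | yes refl | no _ with parent L c ≟ suc a
  ... | yes eq = refl , inj₂ (c , refl , parent≡suc⇒< L eq)
  adj-nonroot {b = suc c} () | yes refl | no _ | no _

  nonroot-sameLeg : ∀ {x y} → ¬ Root x → jellyfishAdj H L x y ≡ true → proj₁ y ≡ proj₁ x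
  nonroot-sameLeg {_ , zero}  ¬root _ = contradiction refl ¬root
  nonroot-sameLeg {_ , suc _} _     e = proj₁ (adj-nonroot e)

  -- A non-root vertex has at most one neighbour, its parent, that is not a child.
  minDegree≥2⇒Root : ∀ {P} → MinDegree≥2 (jellyfish H L) P → ∀ x → P x → Root x
  minDegree≥2⇒Root deg (w , zero)  _ = refl
  minDegree≥2⇒Root {P} deg (w , suc a) p = contradiction p (noNonroot (>-wellFounded a))
    where
    noNonroot : ∀ {a} → Acc _>_ a → ¬ P (w , suc a)
    noNonroot {a} (acc rec) p with deg (w , suc a) p
    ... | y₁ , y₂ , p₁ , p₂ , y₁≢y₂ , e₁ , e₂ =
      y₁≢y₂ (trans (toParent y₁ p₁ e₁) (sym (toParent y₂ p₂ e₂)))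
      where
      toParent : ∀ y → P y → jellyfishAdj H L (w , suc a) y ≡ true → y ≡ (w , parent L a)
      toParent (u , b) py e with adj-nonroot e
      ... | refl , inj₁ refl = refl
      ... | refl , inj₂ (c , refl , a<c) = contradiction py (noNonroot (rec a<c))

  legVertex-irrelevant : ∀ (v : Fin n) (x : Vertex) (p q : legVertex L v x) → p ≡ q
  legVertex-irrelevant _ _ = Decidable⇒UIP.≡-irrelevant _≟_

  leg-≡ : ∀ {v} {x y : V (leg H L v)} → proj₁ x ≡ proj₁ y → x ≡ y
  leg-≡ {v} = induced-≡ {G = jellyfish H L} {P = legVertex L v} (legVertex-irrelevant v)

  rootedLegAutomorphism-preservesRoot : ∀ {v} (ρ : Automorphism (leg H L v)) →
    app ρ (legRoot H L v) ≡ legRoot H L v →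
    ∀ x → isRoot (proj₂ (proj₁ (app ρ x))) ≡ isRoot (proj₂ (proj₁ x))
  rootedLegAutomorphism-preservesRoot ρ ρ-root ((u , zero) , refl) =
    cong (λ z → isRoot (proj₂ (proj₁ z))) ρ-root
  rootedLegAutomorphism-preservesRoot ρ ρ-root x@((u , suc a) , p) with app ρ x in eq
  ... | (_ , suc _) , _ = refl
  ... | (_ , zero) , refl with () ← cong (λ z → proj₂ (proj₁ z))
                                    (app-injective ρ (trans eq (trans (leg-≡ refl) (sym ρ-root))))

  rootedLegAutomorphism-preservesAdjOutside : ∀ {v} (ρ : Automorphism (leg H L v)) →
    app ρ (legRoot H L v) ≡ legRoot H L v → PreservesAdjOutside (jellyfish H L) (legVertex L v) ρ
  rootedLegAutomorphism-preservesAdjOutside ρ ρ-root x y y∉leg =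
    adj-otherLeg-≡ (trans (proj₂ (app ρ x)) (sym (proj₂ x)))
                   (rootedLegAutomorphism-preservesRoot ρ ρ-root x)
                   (λ e → y∉leg (trans (sym e) (proj₂ (app ρ x))))

  liftHead : Automorphism (toGraph H) → Automorphism (jellyfish H L)
  liftHead σ = mkAutomorphism (map₁ (app σ)) (map₁ (app (σ ⁻¹)))
    (λ (u , a) → cong (_, a) (app-⁻¹ σ u)) (λ (u , a) → cong (_, a) (⁻¹-app σ u))
    λ (u , a) (u′ , b) → cong₂ (λ d h → (d ∧ treeAdj L a b) ∨ (isRoot a ∧ isRoot b ∧ h))
                               (⌊≟⌋-injective (app σ) (app-injective σ) u u′) (preserves σ u u′)

  module _ (hc : HamiltonianCycle H) where
    open HamiltonianCycle hc

    roots-minDegree≥2 : MinDegree≥2 (jellyfish H L) Root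
    roots-minDegree≥2 (v , _) refl with injective⇒surjective c c-inj v
    ... | i , refl with cyclicSuccessor i | cyclicPredecessor i
    ... | j , i↝j | j′ , j′↝i =
      (c j , zero) , (c j′ , zero) , refl , refl ,
      (λ e → isCyclicSuccessor-asym atLeast3 i↝j
               (subst (λ m → IsCyclicSuccessor m i) (sym (c-inj j j′ (cong proj₁ e))) j′↝i)) ,
      trans (adj-roots (c i) (c j)) (c-adj i j i↝j) ,
      trans (adj-roots (c i) (c j′)) (trans (SimpleGraph.sym H (c i) (c j′)) (c-adj j′ i j′↝i))

    module _ (π : Automorphism (jellyfish H L)) where

      automorphism-preservesRoot : ∀ x → Root x → Root (app π x)
      automorphism-preservesRoot x r =
        minDegree≥2⇒Root (image-minDegree≥2 π roots-minDegree≥2) (app π x) (x , r , refl)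

      headMap : Fin n → Fin n
      headMap v = proj₁ (app π (v , zero))

      app-root : ∀ v → app π (v , zero) ≡ (headMap v , zero)
      app-root v = cong (headMap v ,_) (automorphism-preservesRoot (v , zero) refl)

    automorphism-reflectsRoot : ∀ (π : Automorphism (jellyfish H L)) x → Root (app π x) → Root x
    automorphism-reflectsRoot π x r =
      subst Root (⁻¹-app π x) (automorphism-preservesRoot (π ⁻¹) (app π x) r)

    headMap-inverse : ∀ π v → headMap π (headMap (π ⁻¹) v) ≡ v
    headMap-inverse π v = cong proj₁ (begin
      app π (headMap (π ⁻¹) v , zero) ≡⟨ cong (app π) (sym (app-root (π ⁻¹) v)) ⟩
      app π (app (π ⁻¹) (v , zero))   ≡⟨ app-⁻¹ π (v , zero) ⟩
      (v , zero)                      ∎)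
      where open ≡-Reasoning

    headAutomorphism : Automorphism (jellyfish H L) → Automorphism (toGraph H)
    headAutomorphism π =
      mkAutomorphism (headMap π) (headMap (π ⁻¹)) (headMap-inverse π) (headMap-inverse (π ⁻¹)) adj-headMap
      where
      open ≡-Reasoning
      adj-headMap : ∀ u v → hadj H (headMap π u) (headMap π v) ≡ hadj H u v
      adj-headMap u v = begin
        hadj H (headMap π u) (headMap π v)
          ≡⟨ sym (adj-roots _ _) ⟩
        jellyfishAdj H L (headMap π u , zero) (headMap π v , zero)
          ≡⟨ sym (cong₂ (jellyfishAdj H L) (app-root π u) (app-root π v)) ⟩
        jellyfishAdj H L (app π (u , zero)) (app π (v , zero))
          ≡⟨ preserves π _ _ ⟩
        jellyfishAdj H L (u , zero) (v , zero)
          ≡⟨ adj-roots u v ⟩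
        hadj H u v ∎

    -- The image of a non-root is a non-root, hence adjacent only inside its own leg.
    automorphism-preservesLeg : ∀ (π : Automorphism (jellyfish H L)) v a →
                                proj₁ (app π (v , a)) ≡ headMap π v
    automorphism-preservesLeg π v = parent-induction L (λ a → proj₁ (app π (v , a)) ≡ headMap π v) refl
      λ i ih → trans (sym (nonroot-sameLeg (0≢1+n ∘ sym ∘ automorphism-reflectsRoot π (v , suc i))
                                         (trans (preserves π _ _) (adj-parent v i)))) ih

    legsFixing×projFixing⇒fixing : ∀ {S} →
      ((v : Fin n) → IsFixingSetRooted (leg H L v) (legRoot H L v) (legSet H L S v)) →
      IsFixingSet (toGraph H) (projSet L S) → IsFixingSet (jellyfish H L) S
    legsFixing×projFixing⇒fixing legs-fixing proj-fixing π π-fixes x@(v , _) =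
      cong proj₁ (legs-fixing v (restrict (legVertex-irrelevant v) π π-keepsLeg π-keepsLeg⁻)
                              (leg-≡ (trans (app-root π v) (cong (_, zero) (headMap-id v))))
                              (λ (s , _) s∈S → leg-≡ (π-fixes s s∈S))
                              (x , refl))
      where
      headMap-id : ∀ v → headMap π v ≡ v
      headMap-id = proj-fixing (headAutomorphism π)
        λ v (a , s∈S) → trans (sym (automorphism-preservesLeg π v a)) (cong proj₁ (π-fixes _ s∈S))

      π-preservesLeg : ∀ x → proj₁ (app π x) ≡ proj₁ x
      π-preservesLeg (v , a) = trans (automorphism-preservesLeg π v a) (headMap-id v)

      π-keepsLeg : ∀ {v x} → legVertex L v x → legVertex L v (app π x)
      π-keepsLeg {x = x} = trans (π-preservesLeg x)

      π-keepsLeg⁻ : ∀ {v x} → legVertex L v (app π x) → legVertex L v x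
      π-keepsLeg⁻ {x = x} = trans (sym (π-preservesLeg x))

  fixing⇒legFixing : ∀ {S} → IsFixingSet (jellyfish H L) S →
                     (v : Fin n) → IsFixingSetRooted (leg H L v) (legRoot H L v) (legSet H L S v)
  fixing⇒legFixing S-fixing v ρ ρ-root =
    fixingSet-fixesExtendable (legVertex-irrelevant v) (λ x → proj₁ x ≟ v) S-fixing ρ
                              (rootedLegAutomorphism-preservesAdjOutside ρ ρ-root)

  fixing⇒projFixing : ∀ {S} → IsFixingSet (jellyfish H L) S → IsFixingSet (toGraph H) (projSet L S)
  fixing⇒projFixing S-fixing σ σ-fixes u =
    cong proj₁ (S-fixing (liftHead σ) (λ (w , a) s∈S → cong (_, a) (σ-fixes w (a , s∈S))) (u , zero))

lemma4 : ∀ {n} (H : SimpleGraph n) → HamiltonianCycle H → (L : RootedTree) →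
         (S : VSet (Fin n × Fin (suc (RootedTree.k L)))) →
         IsFixingSet (jellyfish H L) S ⇔
         (((v : Fin n) → IsFixingSetRooted (leg H L v) (legRoot H L v) (legSet H L S v))
          × IsFixingSet (toGraph H) (projSet L S))
lemma4 H hc L S = mk⇔
  (λ S-fixing → fixing⇒legFixing S-fixing , fixing⇒projFixing S-fixing)
  (λ (legs-fixing , proj-fixing) → legsFixing×projFixing⇒fixing hc legs-fixing proj-fixing)
  where open Jellyfish H L
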